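{- The paraconsistentization $\mathbb{P}(L_3)$ is paraconsistent: there exist $\Gamma\subseteq For$ and $\alpha\in For$ such that $\{\alpha,\neg\alpha\}\subseteq Cn^{\mathbb{P}}_{L_3}(\Gamma)$ but $Cn^{\mathbb{P}}_{L_3}(\Gamma)\neq For$.
   Context: $For$ is the set of formulas built from a countable set $Prop$ of propositional letters with $\neg,\vee,\wedge,\rightarrow$. $L_3$ (Łukasiewicz) is given by the matrix with truth values $\{0,1/2,1\}$, designated set $\{1\}$, $f_\neg(x)=1-x$, $f_\vee=\max$, $f_\wedge=\min$, $f_\rightarrow(x,y)=\min\{1,1-x+y\}$; valuations are maps $Prop\to\{0,1/2,1\}$ extended via these functions. $\Gamma\vDash_{L_3}\alpha$ iff every valuation giving all members of $\Gamma$ value $1$ gives $\alpha$ value $1$; $Cn_{L_3}(\Gamma)=\{\alpha:\Gamma\vDash_{L_3}\alpha\}$; $\Gamma$ is $L_3$-consistent iff $Cn_{L_3}(\Gamma)\neq For$. The paraconsistentization $\mathbb{P}(L_3)$ is the consequence structure $\langle For, Cn^{\mathbb{P}}_{L_3}\rangle$ where $\Gamma\vDash^{\mathbb{P}}_{L_3}\alpha$ iff there exists an $L_3$-consistent $\Gamma'\subseteq\Gamma$ with $\Gamma'\vDash_{L_3}\alpha$, and $Cn^{\mathbb{P}}_{L_3}(\Gamma)=\{\alpha:\Gamma\vDash^{\mathbb{P}}_{L_3}\alpha\}$. -}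

module Defs where

open import Data.Nat using (ℕ)
open import Data.Product using (Σ; ∃; _×_)
open import Relation.Binary.PropositionalEquality using (_≡_)
open import Relation.Nullary using (¬_)
open import Level using (0ℓ)
open import Relation.Unary using (Pred; _⊆_; _∈_)

Prop : Set
Prop = ℕ

data For : Set where
  var  : Prop → For
  ¬'_  : For → For
  _∨'_ : For → For → For
  _∧'_ : For → For → For
  _⇒'_ : For → For → For

-- Truth values {0, 1/2, 1}.
data V : Set where
  v0 vh v1 : V

f¬ : V → V
f¬ v0 = v1
f¬ vh = vh
f¬ v1 = v0

f∨ : V → V → V
f∨ v0 y = y
f∨ vh v0 = vh
f∨ vh vh = vh
f∨ vh v1 = v1
f∨ v1 _ = v1

f∧ : V → V → V
f∧ v0 _ = v0
f∧ vh v0 = v0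
f∧ vh vh = vh
f∧ vh v1 = vh
f∧ v1 y = y

-- min{1, 1 - x + y}
f⇒ : V → V → V
f⇒ v0 _  = v1
f⇒ vh v0 = vh
f⇒ vh vh = v1
f⇒ vh v1 = v1
f⇒ v1 y  = y

Valuation : Set
Valuation = Prop → V

eval : Valuation → For → V
eval v (var p)   = v p
eval v (¬' a)    = f¬ (eval v a)
eval v (a ∨' b)  = f∨ (eval v a) (eval v b)
eval v (a ∧' b)  = f∧ (eval v a) (eval v b)
eval v (a ⇒' b)  = f⇒ (eval v a) (eval v b)

FSet : Set₁
FSet = Pred For 0ℓ

_⊨L3_ : FSet → For → Set
Γ ⊨L3 α = (v : Valuation) → (∀ γ → γ ∈ Γ → eval v γ ≡ v1) → eval v α ≡ v1

CnL3 : FSet → FSet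
CnL3 Γ α = Γ ⊨L3 α

ConsistentL3 : FSet → Set
ConsistentL3 Γ = ¬ (∀ β → β ∈ CnL3 Γ)

_⊨P_ : FSet → For → Set₁
Γ ⊨P α = Σ FSet (λ Γ' → (Γ' ⊆ Γ) × ConsistentL3 Γ' × (Γ' ⊨L3 α))

CnP : FSet → For → Set₁
CnP Γ α = Γ ⊨P α

-- Γ = {p, ¬p} entails both p and ¬p through its consistent subsets {p} and {¬p}.
-- But a consistent subset of Γ has a model, and since Γ only mentions p, that model
-- can be changed to give a fresh letter q the value 0; so no consistent subset of Γ
-- entails q, and Cn^P(Γ) ≠ For.
module Submission where

open import Defs
open import Data.Empty using (⊥-elim)
open import Data.Nat using (zero; suc)
open import Data.Product using (Σ; _×_; _,_)
open import Data.Sum using (inj₁; inj₂)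
open import Relation.Binary.PropositionalEquality using (_≡_; refl; sym; trans)
open import Relation.Nullary using (¬_)
open import Relation.Unary using (_⊆_; _∈_; ｛_｝; _∪_)

Satisfies : Valuation → FSet → Set
Satisfies v Γ = ∀ γ → γ ∈ Γ → eval v γ ≡ v1

⊨L3-member : ∀ {Γ γ} → γ ∈ Γ → Γ ⊨L3 γ
⊨L3-member γ∈Γ v v⊨Γ = v⊨Γ _ γ∈Γ

f⇒-refl : ∀ x → f⇒ x x ≡ v1
f⇒-refl v0 = refl
f⇒-refl vh = refl
f⇒-refl v1 = refl

falsum : For
falsum = ¬' (var 0 ⇒' var 0)

eval-falsum : ∀ v → eval v falsum ≡ v0
eval-falsum v rewrite f⇒-refl (v 0) = refl

v0≢v1 : v0 ≡ v1 → ∀ {a} {A : Set a} → A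
v0≢v1 ()

satisfiable⇒consistent : ∀ {Γ} v → Satisfies v Γ → ConsistentL3 Γ
satisfiable⇒consistent v v⊨Γ explosive =
  v0≢v1 (trans (sym (eval-falsum v)) (explosive falsum v v⊨Γ))

-- Intuitionistically only the double negation of "consistent sets have a model" holds.
consistent⇒¬¬satisfiable : ∀ {Γ} → ConsistentL3 Γ → ¬ (∀ v → ¬ Satisfies v Γ)
consistent⇒¬¬satisfiable consistent unsatisfiable =
  consistent λ β v v⊨Γ → ⊥-elim (unsatisfiable v v⊨Γ)

p q : For
p = var 0
q = var 1

Γ : FSet
Γ = ｛ p ｝ ∪ ｛ ¬' p ｝

p-only : Valuation → Valuation
p-only v zero    = v zero
p-only v (suc _) = v0

p-only-satisfies-Γ : ∀ {Γ'} v → Γ' ⊆ Γ → Satisfies v Γ' → Satisfies (p-only v) Γ'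
p-only-satisfies-Γ v Γ'⊆Γ v⊨Γ' γ γ∈Γ' with Γ'⊆Γ γ∈Γ'
... | inj₁ refl = v⊨Γ' γ γ∈Γ'
... | inj₂ refl = v⊨Γ' γ γ∈Γ'

Γ-⊭P-q : ¬ (Γ ⊨P q)
Γ-⊭P-q (Γ' , Γ'⊆Γ , consistent , Γ'⊨q) =
  consistent⇒¬¬satisfiable consistent λ v v⊨Γ' →
    v0≢v1 (Γ'⊨q (p-only v) (p-only-satisfies-Γ v Γ'⊆Γ v⊨Γ'))

all-true all-false : Valuation
all-true  _ = v1
all-false _ = v0

corollary4 : Σ FSet (λ Γ → Σ For (λ α →
                 (CnP Γ α × CnP Γ (¬' α)) × ¬ (∀ β → CnP Γ β)))
corollary4 = Γ , p , (Γ⊨Pp , Γ⊨P¬p) , λ trivial → Γ-⊭P-q (trivial q)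
  where
  Γ⊨Pp : Γ ⊨P p
  Γ⊨Pp = ｛ p ｝ , inj₁ , satisfiable⇒consistent all-true (λ { _ refl → refl }) , ⊨L3-member refl

  Γ⊨P¬p : Γ ⊨P (¬' p)
  Γ⊨P¬p = ｛ ¬' p ｝ , inj₂ , satisfiable⇒consistent all-false (λ { _ refl → refl }) , ⊨L3-member refl
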